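{- Let $(a(n))_{n\in\mathbb{Z}}$, $(b(n))_{n\in\mathbb{Z}}$, $(c(n))_{n\in\mathbb{Z}}$ be sequences of real numbers with $a(n)=b(n)=c(n)=0$ for $n<0$. Then the matrix identity $$\big(a(i+j-n)\big)_{i,j=0}^{n}\cdot\big(b(n-j-k)\big)_{j,k=0}^{n}=\big(c(i-k)\big)_{i,k=0}^{n}$$ holds for every integer $n\ge 0$ if and only if $\sum_{n\ge0}a(n)x^n\cdot\sum_{n\ge0}b(n)x^n=\sum_{n\ge0}c(n)x^n$ as formal power series. -}

module Defs where

open import Level using (Level)
open import Algebra.Bundles using (CommutativeRing)
open import Data.Nat using (ℕ; suc; _∸_)
open import Data.Integer using (ℤ; +_; -[1+_]) renaming (_+_ to _⊕_; _-_ to _⊖_)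
open import Data.Fin using (Fin; toℕ)
import Algebra.Definitions.RawMonoid as RM

module _ {c ℓ : Level} (R : CommutativeRing c ℓ) where
  open CommutativeRing R

  Σ : ∀ {n} → (Fin n → Carrier) → Carrier
  Σ = RM.sum +-rawMonoid

  VanishesNeg : (ℤ → Carrier) → Set ℓ
  VanishesNeg a = ∀ (n : ℕ) → a -[1+ n ] ≈ 0#

  Mat : ℕ → Set c
  Mat n = Fin (suc n) → Fin (suc n) → Carrier

  matMul : ∀ {n} → Mat n → Mat n → Mat n
  matMul A B i k = Σ (λ j → A i j * B j k)

  MatEq : ∀ {n} → Mat n → Mat n → Set ℓ
  MatEq A B = ∀ i k → A i k ≈ B i k

  ι : ∀ {m} → Fin m → ℤ
  ι i = + toℕ i

  matA : (ℤ → Carrier) → (n : ℕ) → Mat n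
  matA a n i j = a ((ι i ⊕ ι j) ⊖ (+ n))

  matB : (ℤ → Carrier) → (n : ℕ) → Mat n
  matB b n j k = b ((+ n ⊖ ι j) ⊖ ι k)

  matC : (ℤ → Carrier) → (n : ℕ) → Mat n
  matC c' n i k = c' (ι i ⊖ ι k)

  PowerSeries : Set c
  PowerSeries = ℕ → Carrier

  toPS : (ℤ → Carrier) → PowerSeries
  toPS a n = a (+ n)

  _·ₚ_ : PowerSeries → PowerSeries → PowerSeries
  (f ·ₚ g) d = Σ {suc d} (λ m → f (toℕ m) * g (d ∸ toℕ m))

  _≈ₚ_ : PowerSeries → PowerSeries → Set ℓ
  f ≈ₚ g = ∀ d → f d ≈ g d

{-# OPTIONS --safe #-}
module Submission where

-- Entry (i, k) of the n-th product is ∑ⱼ a(i + j - n) b(n - j - k). Only j ≥ n - i contribute,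
-- and with m = i + j - n the entry becomes ∑ₘ a(m) b(i - k - m), the coefficient of x^(i-k) in
-- the product series (0 when i < k). Hence the matrix identities say that c(i - k) is that
-- coefficient; conversely the corner entry i = n, k = 0 recovers every coefficient.

open import Defs
open import Level using (Level)
open import Algebra.Bundles using (CommutativeRing)
open import Data.Nat using (ℕ; zero; suc; _∸_; z<s; s<s)
import Data.Nat as ℕ
import Data.Nat.Properties as ℕ
open import Data.Integer using (ℤ; +_; -[1+_]; +<+; -<+; +≤+; 0ℤ)
import Data.Integer as ℤ
import Data.Integer.Properties as ℤ
open import Data.Integer.Tactic.RingSolver using (solve-∀)
open import Data.Fin using (Fin; toℕ; fromℕ) renaming (zero to fzero)
open import Data.Fin.Properties using (toℕ-fromℕ; toℕ≤pred[n])
open import Data.Product using (_×_; _,_)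
open import Relation.Binary.PropositionalEquality as ≡ using (_≡_)

m<n⇒+m-+n<0 : ∀ {m n} → m ℕ.< n → + m ℤ.- + n ℤ.< 0ℤ
m<n⇒+m-+n<0 {m} {n} m<n =
  ℤ.<-≤-trans (ℤ.+-monoˡ-< (ℤ.- + n) (+<+ m<n)) (ℤ.≤-reflexive (ℤ.+-inverseʳ (+ n)))

m≤n⇒+n-+m≡+[n∸m] : ∀ {m n} → m ℕ.≤ n → + n ℤ.- + m ≡ + (n ∸ m)
m≤n⇒+n-+m≡+[n∸m] {m} {n} m≤n = ≡.trans (ℤ.m-n≡m⊖n n m) (ℤ.⊖-≥ m≤n)

[i+[e+m]]-[e+i]≡m : ∀ i e m → (i ℤ.+ (e ℤ.+ m)) ℤ.- (e ℤ.+ i) ≡ m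
[i+[e+m]]-[e+i]≡m = solve-∀

[[e+i]-[e+m]]-k≡[i-k]-m : ∀ i e m k → ((e ℤ.+ i) ℤ.- (e ℤ.+ m)) ℤ.- k ≡ (i ℤ.- k) ℤ.- m
[[e+i]-[e+m]]-k≡[i-k]-m = solve-∀

module _ {c ℓ : Level} (R : CommutativeRing c ℓ) where
  open CommutativeRing R
  open import Relation.Binary.Reasoning.Setoid setoid

  ∑< : ℕ → (ℕ → Carrier) → Carrier
  ∑< n f = Σ R {n} (λ j → f (toℕ j))

  ∑<-cong : ∀ n {f g : ℕ → Carrier} → (∀ j → j ℕ.< n → f j ≈ g j) → ∑< n f ≈ ∑< n g
  ∑<-cong zero    f≈g = refl
  ∑<-cong (suc n) f≈g = +-cong (f≈g 0 z<s) (∑<-cong n (λ j j<n → f≈g (suc j) (s<s j<n)))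

  ∑<-zero : ∀ n (f : ℕ → Carrier) → (∀ j → j ℕ.< n → f j ≈ 0#) → ∑< n f ≈ 0#
  ∑<-zero zero    f f≈0 = refl
  ∑<-zero (suc n) f f≈0 =
    trans (+-cong (f≈0 0 z<s) (∑<-zero n (λ j → f (suc j)) (λ j j<n → f≈0 (suc j) (s<s j<n))))
          (+-identityˡ 0#)

  ∑<-+ : ∀ m n (f : ℕ → Carrier) → ∑< (m ℕ.+ n) f ≈ ∑< m f + ∑< n (λ j → f (m ℕ.+ j))
  ∑<-+ zero    n f = sym (+-identityˡ _)
  ∑<-+ (suc m) n f = trans (+-congˡ (∑<-+ m n (λ j → f (suc j)))) (sym (+-assoc _ _ _))

  vanishes-<0 : ∀ a → VanishesNeg R a → ∀ {z} → z ℤ.< 0ℤ → a z ≈ 0#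
  vanishes-<0 a va { -[1+ n ]} _         = va n
  vanishes-<0 a va { + n }     (+<+ ())

  module Convolution {a b : ℤ → Carrier} (va : VanishesNeg R a) (vb : VanishesNeg R b) where

    convolution : ℤ → Carrier
    convolution (+ d)    = _·ₚ_ R (toPS R a) (toPS R b) d
    convolution -[1+ _ ] = 0#

    convolution≈ : ∀ {c'} → VanishesNeg R c' → _≈ₚ_ R (_·ₚ_ R (toPS R a) (toPS R b)) (toPS R c') →
                   ∀ z → convolution z ≈ c' z
    convolution≈ vc ab≈c (+ d)    = ab≈c d
    convolution≈ vc ab≈c -[1+ t ] = sym (vc t)

    ∑<-convolution : ∀ z i → z ℤ.≤ + i → ∑< (suc i) (λ m → a (+ m) * b (z ℤ.- + m)) ≈ convolution z
    ∑<-convolution -[1+ t ] i _ = ∑<-zero (suc i) (λ m → a (+ m) * b (-[1+ t ] ℤ.- + m)) λ m _ →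
      trans (*-congˡ (vanishes-<0 b vb (ℤ.≤-<-trans (ℤ.i-j≤i -[1+ t ] (+ m)) -<+))) (zeroʳ _)
    ∑<-convolution (+ d) i (+≤+ d≤i) with ℕ.m≤n⇒∃[o]m+o≡n d≤i
    ... | r , ≡.refl = begin
      ∑< (suc d ℕ.+ r) g                                 ≈⟨ ∑<-+ (suc d) r g ⟩
      ∑< (suc d) g + ∑< r (λ t → g (suc d ℕ.+ t))       ≈⟨ +-cong support beyond ⟩
      convolution (+ d) + 0#                             ≈⟨ +-identityʳ _ ⟩
      convolution (+ d)                                  ∎
      where
      g : ℕ → Carrier
      g m = a (+ m) * b (+ d ℤ.- + m)
      support : ∑< (suc d) g ≈ convolution (+ d)
      support = ∑<-cong (suc d) λ m m<1+d →
        reflexive (≡.cong (λ z → a (+ m) * b z) (m≤n⇒+n-+m≡+[n∸m] (ℕ.≤-pred m<1+d)))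
      beyond : ∑< r (λ t → g (suc d ℕ.+ t)) ≈ 0#
      beyond = ∑<-zero r (λ t → g (suc d ℕ.+ t)) λ t _ →
        trans (*-congˡ (vanishes-<0 b vb (m<n⇒+m-+n<0 (s<s (ℕ.m≤m+n d t))))) (zeroʳ _)

    productTerm : ℕ → ℕ → ℕ → ℕ → Carrier
    productTerm n i k j = a ((+ i ℤ.+ + j) ℤ.- + n) * b ((+ n ℤ.- + j) ℤ.- + k)

    ∑<-productTerm : ∀ {n} e i k → e ℕ.+ i ≡ n →
                     ∑< (suc n) (productTerm n i k) ≈ ∑< (suc i) (λ m → a (+ m) * b ((+ i ℤ.- + k) ℤ.- + m))
    ∑<-productTerm e i k ≡.refl = begin
      ∑< (suc (e ℕ.+ i)) f                         ≡⟨ ≡.cong (λ l → ∑< l f) (≡.sym (ℕ.+-suc e i)) ⟩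
      ∑< (e ℕ.+ suc i) f                           ≈⟨ ∑<-+ e (suc i) f ⟩
      ∑< e f + ∑< (suc i) (λ m → f (e ℕ.+ m))     ≈⟨ +-cong below (∑<-cong (suc i) λ m _ → reflexive (shift m)) ⟩
      0# + ∑< (suc i) window                      ≈⟨ +-identityˡ _ ⟩
      ∑< (suc i) window                           ∎
      where
      f : ℕ → Carrier
      f = productTerm (e ℕ.+ i) i k
      window : ℕ → Carrier
      window m = a (+ m) * b ((+ i ℤ.- + k) ℤ.- + m)
      below : ∑< e f ≈ 0#
      below = ∑<-zero e f λ j j<e →
        trans (*-congʳ (vanishes-<0 a va (m<n⇒+m-+n<0
                 (≡.subst (ℕ._< e ℕ.+ i) (ℕ.+-comm j i) (ℕ.+-monoˡ-< i j<e)))))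
              (zeroˡ _)
      shift : ∀ m → f (e ℕ.+ m) ≡ window m
      shift m = ≡.cong₂ (λ x y → a x * b y)
        ([i+[e+m]]-[e+i]≡m (+ i) (+ e) (+ m)) ([[e+i]-[e+m]]-k≡[i-k]-m (+ i) (+ e) (+ m) (+ k))

    matMul-entry : ∀ n (i k : Fin (suc n)) →
                   matMul R (matA R a n) (matB R b n) i k ≈ convolution (ι R i ℤ.- ι R k)
    matMul-entry n i k = trans
      (∑<-productTerm (n ∸ toℕ i) (toℕ i) (toℕ k) (ℕ.m∸n+n≡m (toℕ≤pred[n] i)))
      (∑<-convolution (ι R i ℤ.- ι R k) (toℕ i) (ℤ.i-j≤i (ι R i) (ι R k)))

lemma10 : {c ℓ : Level} (R : CommutativeRing c ℓ) →
          (a b c' : ℤ → CommutativeRing.Carrier R) →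
          VanishesNeg R a → VanishesNeg R b → VanishesNeg R c' →
          (((n : ℕ) → MatEq R (matMul R (matA R a n) (matB R b n)) (matC R c' n)) →
            _≈ₚ_ R (_·ₚ_ R (toPS R a) (toPS R b)) (toPS R c'))
          × (_≈ₚ_ R (_·ₚ_ R (toPS R a) (toPS R b)) (toPS R c') →
            ((n : ℕ) → MatEq R (matMul R (matA R a n) (matB R b n)) (matC R c' n)))
lemma10 R a b c' va vb vc = matrices⇒series , series⇒matrices
  where
  open CommutativeRing R
  open Convolution R {a} {b} va vb
  open import Relation.Binary.Reasoning.Setoid setoid

  corner : ∀ d → ι R (fromℕ d) ℤ.- ι R (fzero {d}) ≡ + d
  corner d = ≡.trans (ℤ.+-identityʳ _) (≡.cong +_ (toℕ-fromℕ d))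

  matrices⇒series : (∀ n → MatEq R (matMul R (matA R a n) (matB R b n)) (matC R c' n)) →
                    _≈ₚ_ R (_·ₚ_ R (toPS R a) (toPS R b)) (toPS R c')
  matrices⇒series H d = begin
    convolution (+ d)                                    ≡⟨ ≡.cong convolution (corner d) ⟨
    convolution (ι R (fromℕ d) ℤ.- ι R (fzero {d}))      ≈⟨ matMul-entry d (fromℕ d) fzero ⟨
    matMul R (matA R a d) (matB R b d) (fromℕ d) fzero   ≈⟨ H d (fromℕ d) fzero ⟩
    c' (ι R (fromℕ d) ℤ.- ι R (fzero {d}))               ≡⟨ ≡.cong c' (corner d) ⟩
    c' (+ d)                                             ∎

  series⇒matrices : _≈ₚ_ R (_·ₚ_ R (toPS R a) (toPS R b)) (toPS R c') →
                    ∀ n → MatEq R (matMul R (matA R a n) (matB R b n)) (matC R c' n)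
  series⇒matrices ab≈c n i k = trans (matMul-entry n i k) (convolution≈ {c'} vc ab≈c _)
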